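{- Let $n\geq1$ and $\theta\in\mathfrak S_n$. There is a bijection $\Psi:\mathfrak C(\theta)\to\mathcal S(\theta)$ such that, whenever $(\mathfrak m,\ell)=\Psi(\gamma,\sigma)$: (1) each vertex $v$ of $\mathfrak m$ that is not a local minimum satisfies $\pi_v\in\mathrm{Cyc}(\sigma_-)$ and $\ell(v)=\gamma(\pi_v)$ (the value of $\gamma$ on the support of $\pi_v$); (2) each frustrated edge $e$ of $\mathfrak m$ satisfies $\pi_e\in\mathrm{Cyc}(\sigma_0)$, a cycle of length 2; (3) $\sigma=\prod_v\pi_v\prod_e\pi_e$, the products being over the vertices that are not local minima and over the frustrated edges.
   Context: $\mathrm{Motz}_{n,0}(\theta)$ is the set of $\gamma:[n]\to\{0,1,2,\ldots\}$ with $\min\gamma=0$ and $|\gamma(i)-\gamma(\theta(i))|\le1$ for all $i$; $\Delta\gamma_\epsilon=\{i:\gamma(\theta(i))-\gamma(i)=\epsilon\}$ for $\epsilon\in\{+1,0,-1\}$. $\mathfrak S^\gamma$ is the set of $\sigma\in\mathfrak S_n$ with $\gamma\circ\sigma=\gamma$ restricting to a permutation $\sigma_-$ of $\Delta\gamma_-$, the identity on $\Delta\gamma_+$, and a fixed-point-free involution $\sigma_0$ of $\Delta\gamma_0$. $\mathfrak C(\theta)$ is the set of pairs $(\gamma,\sigma)$ with $\gamma\in\mathrm{Motz}_{n,0}(\theta)$, $\sigma\in\mathfrak S^\gamma$, and the group generated by $\theta,\sigma$ acting transitively on $[n]$. Maps: connected graphs cellularly embedded in a compact orientable surface up to orientation-preserving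 homeomorphism; half-edge-labelled by $[n]$ (labels preserved by isomorphisms). With $\rho$ the permutation listing half-edge labels clockwise around each vertex and $\alpha$ the involution pairing the half-edges of each edge, the face permutation is $\varphi_{\mathfrak m}=\rho^{ -1}\alpha$. A suitably labelled map carries $\ell:V\to\{0,1,\ldots\}$ with $\min\ell=0$ and $|\ell(v)-\ell(w)|\le1$ for adjacent $v,w$. $\mathcal S(\theta)$ is the set of half-edge-labelled (by $[n]$) suitably labelled maps (any genus) with $\varphi_{\mathfrak m}=\theta$. A local minimum is a vertex with no neighbour of strictly smaller label. An edge is frustrated if its endpoints have equal labels; for such an edge $e$ with half-edges labelled $i,j$, $\pi_e=(i\,j)$. For a vertex $v$, $\pi_v=(u_1\,\cdots\,u_d)$ where $u_1,\ldots,u_d$ are the labels, in clockwise order around $v$, of the half-edges at $v$ belonging to an edge joining $v$ to a vertex of strictly smaller label. -}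

module Defs where

open import Data.Nat using (ℕ; zero; suc; _≤_; _<_; _<?_; ∣_-_∣)
open import Data.Fin using (Fin)
open import Data.Bool using (Bool; if_then_else_)
open import Data.Product using (Σ; ∃; _×_; _,_; proj₁)
open import Data.Fin.Permutation using (Permutation′; _⟨$⟩ʳ_; _⟨$⟩ˡ_)
open import Relation.Nullary using (does; ¬_)
open import Relation.Binary.PropositionalEquality using (_≡_; _≢_)

data Reach {n : ℕ} (p q : Permutation′ n) : Fin n → Fin n → Set where
  here  : ∀ {i} → Reach p q i i
  pFwd  : ∀ {i j} → Reach p q (p ⟨$⟩ʳ i) j → Reach p q i j
  pBwd  : ∀ {i j} → Reach p q (p ⟨$⟩ˡ i) j → Reach p q i j
  qFwd  : ∀ {i j} → Reach p q (q ⟨$⟩ʳ i) j → Reach p q i j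
  qBwd  : ∀ {i j} → Reach p q (q ⟨$⟩ˡ i) j → Reach p q i j

Transitive : {n : ℕ} → Permutation′ n → Permutation′ n → Set
Transitive {n} p q = (i j : Fin n) → Reach p q i j

IsMotz : {n : ℕ} → Permutation′ n → (Fin n → ℕ) → Set
IsMotz {n} θ γ = (∃ λ i → γ i ≡ 0) × ((i : Fin n) → ∣ γ i - γ (θ ⟨$⟩ʳ i) ∣ ≤ 1)

InΔ+ : {n : ℕ} → Permutation′ n → (Fin n → ℕ) → Fin n → Set
InΔ+ θ γ i = γ (θ ⟨$⟩ʳ i) ≡ suc (γ i)

InΔ0 : {n : ℕ} → Permutation′ n → (Fin n → ℕ) → Fin n → Set
InΔ0 θ γ i = γ (θ ⟨$⟩ʳ i) ≡ γ i

InΔ- : {n : ℕ} → Permutation′ n → (Fin n → ℕ) → Fin n → Set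
InΔ- θ γ i = suc (γ (θ ⟨$⟩ʳ i)) ≡ γ i

InSγ : {n : ℕ} → Permutation′ n → (Fin n → ℕ) → Permutation′ n → Set
InSγ {n} θ γ σ =
    ((i : Fin n) → γ (σ ⟨$⟩ʳ i) ≡ γ i)
  -- σ restricts to a permutation of Δγ_- (σ is a bijection of [n] mapping Δγ_- into itself)
  × ((i : Fin n) → InΔ- θ γ i → InΔ- θ γ (σ ⟨$⟩ʳ i))
  × ((i : Fin n) → InΔ+ θ γ i → σ ⟨$⟩ʳ i ≡ i)
  × ((i : Fin n) → InΔ0 θ γ i →
        InΔ0 θ γ (σ ⟨$⟩ʳ i) × (σ ⟨$⟩ʳ (σ ⟨$⟩ʳ i) ≡ i) × (σ ⟨$⟩ʳ i ≢ i))

record C {n : ℕ} (θ : Permutation′ n) : Set where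
  field
    γ      : Fin n → ℕ
    σ      : Permutation′ n
    motz   : IsMotz θ γ
    inSγ   : InSγ θ γ σ
    trans  : Transitive θ σ

_≈C_ : {n : ℕ} {θ : Permutation′ n} → C θ → C θ → Set
_≈C_ {n} c c' = ((i : Fin n) → C.γ c i ≡ C.γ c' i)
              × ((i : Fin n) → C.σ c ⟨$⟩ʳ i ≡ C.σ c' ⟨$⟩ʳ i)

-- Half-edge-labelled labelled maps, encoded by (ρ, α, ℓ):
-- ρ = clockwise rotation around vertices (vertices = ρ-cycles),
-- α = fixed-point-free involution pairing the half-edges of each edge,
-- ℓ = vertex labelling, given on half-edges and constant on ρ-cycles.
-- Face permutation φ = ρ⁻¹ α, i.e. φ(i) = ρ⁻¹(α(i)).

record S {n : ℕ} (θ : Permutation′ n) : Set where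
  field
    ρ       : Permutation′ n
    α       : Permutation′ n
    ℓ       : Fin n → ℕ
    α-invol : (i : Fin n) → α ⟨$⟩ʳ (α ⟨$⟩ʳ i) ≡ i
    α-fpf   : (i : Fin n) → α ⟨$⟩ʳ i ≢ i
    conn    : Transitive ρ α
    face    : (i : Fin n) → ρ ⟨$⟩ˡ (α ⟨$⟩ʳ i) ≡ θ ⟨$⟩ʳ i
    ℓ-vert  : (i : Fin n) → ℓ (ρ ⟨$⟩ʳ i) ≡ ℓ i
    ℓ-min   : ∃ λ i → ℓ i ≡ 0
    ℓ-adj   : (i : Fin n) → ∣ ℓ i - ℓ (α ⟨$⟩ʳ i) ∣ ≤ 1

_≈S_ : {n : ℕ} {θ : Permutation′ n} → S θ → S θ → Set
_≈S_ {n} s s' = ((i : Fin n) → S.ρ s ⟨$⟩ʳ i ≡ S.ρ s' ⟨$⟩ʳ i)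
              × ((i : Fin n) → S.α s ⟨$⟩ʳ i ≡ S.α s' ⟨$⟩ʳ i)
              × ((i : Fin n) → S.ℓ s i ≡ S.ℓ s' i)

module _ {n : ℕ} {θ : Permutation′ n} (m : S θ) where
  open S m

  -- half-edge u belongs to an edge joining its vertex to a vertex of
  -- strictly smaller label (u lies in the support of π_v, v its vertex)
  Down : Fin n → Set
  Down u = ℓ (α ⟨$⟩ʳ u) < ℓ u

  down? : Fin n → Bool
  down? u = does (ℓ (α ⟨$⟩ʳ u) <? ℓ u)

  Frustrated : Fin n → Set
  Frustrated u = ℓ u ≡ ℓ (α ⟨$⟩ʳ u)

  searchDown : ℕ → Fin n → Fin n
  searchDown zero    u = u
  searchDown (suc k) u =
    if down? (ρ ⟨$⟩ʳ u) then ρ ⟨$⟩ʳ u else searchDown k (ρ ⟨$⟩ʳ u)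

  -- π_v(u) for u in the support of π_v = (u₁ ⋯ u_d)
  -- (the first ρ^k u, 1 ≤ k ≤ n, that is a down-half-edge)
  πV : Fin n → Fin n
  πV u = searchDown n u

  -- the product ∏_v π_v ∏_e π_e of disjoint cycles (v over non-local-minima,
  -- e over frustrated edges), as a function on [n]
  prodπ : Fin n → Fin n
  prodπ u = if down? u then πV u
            else (if does (ℓ u Data.Nat.≟ ℓ (α ⟨$⟩ʳ u)) then α ⟨$⟩ʳ u else u)

Props : {n : ℕ} {θ : Permutation′ n} → C θ → S θ → Set
Props {n} {θ} c m =
  -- (1) for every u in the support of π_v (v not a local minimum):
  --     u ∈ Δγ_-, σ agrees with the cycle π_v at u (so π_v ∈ Cyc(σ_-)),
  --     and ℓ(v) = γ(u)
    ((u : Fin n) → Down m u →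
        InΔ- θ (C.γ c) u × (C.σ c ⟨$⟩ʳ u ≡ πV m u) × (S.ℓ m u ≡ C.γ c u))
  -- (2) for every frustrated edge e = {u, α u}: π_e = (u α(u)) ∈ Cyc(σ_0)
  × ((u : Fin n) → Frustrated m u →
        InΔ0 θ (C.γ c) u × (C.σ c ⟨$⟩ʳ u ≡ S.α m ⟨$⟩ʳ u))
  × ((u : Fin n) → C.σ c ⟨$⟩ʳ u ≡ prodπ m u)

-- Ψ keeps the half-edges and the labels γ and builds the edge involution α from the
-- contour τ = θσ: a half-edge x with γ(θ x) = γ x + 1 is paired with θ⁻¹ of the point
-- where τ, started at x, first comes back down to level γ x; flat half-edges are paired
-- by σ, and the rotation is ρ = α θ⁻¹.  The heart of the proof is that in a labelled map
-- in which σ pairs flat half-edges and fixes ascending ones, two properties are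
-- equivalent: σ sends each descending half-edge to the next descending one clockwise
-- around its vertex (this is (1), and gives (3)), and from each ascending half-edge x
-- the contour first comes back to level ℓ x at θ(α x) (this says that α is built as
-- above).  Both directions rest on one walk: turning counterclockwise around a vertex of
-- label h + 1 from a descending half-edge d, the contour started at α d crosses each flat
-- corner in one step and each ascending corner by an excursion above h + 1, so it stays
-- above h up to the previous descending half-edge.  The first property yields the second
-- by downward induction on the level, which gives the inverse of Ψ; injectivity is (3).

module Submission where

open import Defs
open import Data.Nat
open import Data.Nat.Properties
open import Data.Bool using (Bool; true; false; if_then_else_)
open import Data.Fin using (Fin; toℕ)
open import Data.Fin.Properties using (pigeonhole; toℕ<n)
open import Data.Fin.Permutation
  using (Permutation′; permutation; _⟨$⟩ʳ_; _⟨$⟩ˡ_; inverseˡ; inverseʳ; flip; _∘ₚ_)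
open import Data.List using (map; allFin)
open import Data.List.Extrema.Nat using (max; xs≤max)
import Data.List.Relation.Unary.All as All
open import Data.List.Membership.Propositional.Properties using (∈-map⁺; ∈-allFin)
open import Data.Product using (Σ; ∃; _×_; _,_; proj₁; proj₂)
open import Data.Empty using (⊥)
open import Data.Sum using (inj₁; inj₂)
open import Function using (_∘_)
open import Relation.Nullary using (Dec; yes; no; ¬_; does; contradiction)
open import Relation.Nullary.Decidable using (dec-true; dec-false)
open import Relation.Unary using (Decidable)
open import Relation.Binary.PropositionalEquality
open import Relation.Binary.Definitions using (tri<; tri≈; tri>)

module _ {A : Set} where

  iterate : (A → A) → ℕ → A → A
  iterate f zero    x = x
  iterate f (suc k) x = iterate f k (f x)

  iterate-suc : ∀ f k x → iterate f (suc k) x ≡ f (iterate f k x)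
  iterate-suc f zero    x = refl
  iterate-suc f (suc k) x = iterate-suc f k (f x)

  iterate-+ : ∀ f i j x → iterate f (i + j) x ≡ iterate f j (iterate f i x)
  iterate-+ f zero    j x = refl
  iterate-+ f (suc i) j x = iterate-+ f i j (f x)

  iterate-invariant : ∀ {B : Set} (L : A → B) {f} → (∀ x → L (f x) ≡ L x) →
                      ∀ k x → L (iterate f k x) ≡ L x
  iterate-invariant L inv zero    x = refl
  iterate-invariant L inv (suc k) x = trans (iterate-invariant L inv k _) (inv x)

  iterate-cancel : ∀ {f g} → (∀ x → g (f x) ≡ x) →
                   ∀ i j x → iterate g i (iterate f (i + j) x) ≡ iterate f j x
  iterate-cancel gf zero    j x = refl
  iterate-cancel {f} {g} gf (suc i) j x = begin
    iterate g i (g (iterate f (suc (i + j)) x))  ≡⟨ cong (iterate g i ∘ g) (iterate-suc f (i + j) x) ⟩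
    iterate g i (g (f (iterate f (i + j) x)))    ≡⟨ cong (iterate g i) (gf _) ⟩
    iterate g i (iterate f (i + j) x)            ≡⟨ iterate-cancel gf i j x ⟩
    iterate f j x                                ∎
    where open ≡-Reasoning

  iterate-cancel₀ : ∀ {f g} → (∀ x → g (f x) ≡ x) → ∀ k x → iterate g k (iterate f k x) ≡ x
  iterate-cancel₀ {f} {g} gf k x =
    trans (cong (λ j → iterate g k (iterate f j x)) (sym (+-identityʳ k)))
          (iterate-cancel gf k 0 x)

  -- the first of f x, …, f^N x in P, or f^N x if there is none
  search : (A → A) → {P : A → Set} → Decidable P → ℕ → A → A
  search f P? zero    x = x
  search f P? (suc N) x = if does (P? (f x)) then f x else search f P? N (f x)

  search-invariant : ∀ {B : Set} (L : A → B) {f} → (∀ x → L (f x) ≡ L x) →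
                     ∀ {P} (P? : Decidable P) N x → L (search f P? N x) ≡ L x
  search-invariant L inv P? zero    x = refl
  search-invariant L {f} inv P? (suc N) x with does (P? (f x))
  ... | true  = inv x
  ... | false = trans (search-invariant L inv P? N (f x)) (inv x)

  search-cong : ∀ {f f′ P Q} (P? : Decidable P) (Q? : Decidable Q) →
                (∀ x → f x ≡ f′ x) → (∀ x → does (P? x) ≡ does (Q? x)) →
                ∀ N x → search f P? N x ≡ search f′ Q? N x
  search-cong P? Q? f≗f′ P≗Q zero    x = refl
  search-cong {f′ = f′} P? Q? f≗f′ P≗Q (suc N) x rewrite f≗f′ x | P≗Q (f′ x) =
    cong (if does (Q? (f′ x)) then f′ x else_) (search-cong P? Q? f≗f′ P≗Q N (f′ x))

  -- k counts the failed steps: the orbit of x enters P for the first time at time suc k.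
  record FirstHit (f : A → A) (P : A → Set) (x : A) (k : ℕ) : Set where
    field
      hit  : P (iterate f (suc k) x)
      miss : ∀ {i} → i < k → ¬ P (iterate f (suc i) x)

  open FirstHit public

  module _ {f : A → A} {P : A → Set} where

    firstHit-unique : ∀ {x k k′} → FirstHit f P x k → FirstHit f P x k′ → k ≡ k′
    firstHit-unique {k = k} {k′} h h′ with <-cmp k k′
    ... | tri< k<k′ _ _ = contradiction (hit h) (miss h′ k<k′)
    ... | tri≈ _ k≡k′ _ = k≡k′
    ... | tri> _ _ k′<k = contradiction (hit h′) (miss h k′<k)

    firstHit-tail : ∀ {x k} → FirstHit f P x (suc k) → FirstHit f P (f x) k
    firstHit-tail h = record { hit = hit h ; miss = λ i<k → miss h (s<s i<k) }

    firstHit-cons : ∀ {x k} → ¬ P (f x) → FirstHit f P (f x) k → FirstHit f P x (suc k)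
    firstHit-cons {x} ¬p h = record { hit = hit h ; miss = missed }
      where
      missed : ∀ {i} → i < suc _ → ¬ P (iterate f (suc i) x)
      missed {zero}  _         = ¬p
      missed {suc i} (s<s i<k) = miss h i<k

    firstHit-within : (P? : Decidable P) → ∀ K {x} → P (iterate f (suc K) x) →
                      ∃ λ k → FirstHit f P x k
    firstHit-within P? zero    p = 0 , record { hit = p ; miss = λ () }
    firstHit-within P? (suc K) {x} p with P? (f x)
    ... | yes q = 0 , record { hit = q ; miss = λ () }
    ... | no ¬q with k , h ← firstHit-within P? K p = suc k , firstHit-cons ¬q h

    search-reaches : (P? : Decidable P) → ∀ {x k N} → FirstHit f P x k → k < N →
                     search f P? N x ≡ iterate f (suc k) x
    search-reaches P? {x} {zero}  {suc N} h _ with P? (f x)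
    ... | yes _ = refl
    ... | no ¬p = contradiction (hit h) ¬p
    search-reaches P? {x} {suc k} {suc N} h (s<s k<N) with P? (f x)
    ... | yes p = contradiction p (miss h z<s)
    ... | no _  = search-reaches P? (firstHit-tail h) k<N

  FirstReturn : (A → A) → (A → ℕ) → A → A → Set
  FirstReturn f L x y = ∃ λ k → FirstHit f (λ z → L z ≤ L x) x k × iterate f (suc k) x ≡ y

  firstReturn-unique : ∀ {f L x y z} → FirstReturn f L x y → FirstReturn f L x z → y ≡ z
  firstReturn-unique {f} {x = x} (k , h , refl) (k′ , h′ , refl) =
    cong (λ j → iterate f (suc j) x) (firstHit-unique h h′)

<-split : ∀ {i k} → i < k → ∃ λ j → j < k × suc k ≡ suc i + suc j
<-split {i} {k} i<k with j , i+j≡k ← m≤n⇒∃[o]m+o≡n i<k =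
  j , ≤-trans (s≤s (m≤n+m j i)) (≤-reflexive i+j≡k) ,
  trans (cong suc (sym i+j≡k)) (sym (cong suc (+-suc i j)))

module _ {n : ℕ} (π : Permutation′ n) where

  orbit-returns : ∀ x → ∃ λ p → p < n × iterate (π ⟨$⟩ʳ_) (suc p) x ≡ x
  orbit-returns x
    with i , j , i<j , orbit-i≡j ← pigeonhole (n<1+n n) (λ i → iterate (π ⟨$⟩ʳ_) (toℕ i) x)
    with p , i+p≡j ← m≤n⇒∃[o]m+o≡n i<j =
    p , ≤-trans (s≤s (m≤n+m p (toℕ i))) (≤-trans (≤-reflexive i+p≡j) (≤-pred (toℕ<n j))) ,
    (begin
      iterate f (suc p) x                              ≡⟨ iterate-cancel (λ _ → inverseˡ π) (toℕ i) (suc p) x ⟨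
      iterate g (toℕ i) (iterate f (toℕ i + suc p) x)  ≡⟨ cong (iterate g (toℕ i)) orbit-i+p≡i ⟩
      iterate g (toℕ i) (iterate f (toℕ i + 0) x)      ≡⟨ iterate-cancel (λ _ → inverseˡ π) (toℕ i) 0 x ⟩
      x                                                ∎)
    where
    open ≡-Reasoning
    f g : Fin n → Fin n
    f = π ⟨$⟩ʳ_
    g = π ⟨$⟩ˡ_
    orbit-i+p≡i : iterate f (toℕ i + suc p) x ≡ iterate f (toℕ i + 0) x
    orbit-i+p≡i = begin
      iterate f (toℕ i + suc p) x  ≡⟨ cong (λ t → iterate f t x) (trans (+-suc (toℕ i) p) i+p≡j) ⟩
      iterate f (toℕ j) x          ≡⟨ orbit-i≡j ⟨
      iterate f (toℕ i) x          ≡⟨ cong (λ t → iterate f t x) (+-identityʳ (toℕ i)) ⟨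
      iterate f (toℕ i + 0) x      ∎

  module _ {P : Fin n → Set} where

    private
      f g : Fin n → Fin n
      f = π ⟨$⟩ʳ_
      g = π ⟨$⟩ˡ_

    firstHit-< : ∀ {x k} → FirstHit f P x k → k < n
    firstHit-< {x} {k} h with orbit-returns x
    ... | p , p<n , returns with k ≤? p
    ... | yes k≤p = ≤-<-trans k≤p p<n
    ... | no k≰p with j , j<k , k≡p+j ← <-split (≰⇒> k≰p) =
      contradiction (subst P wrapped (hit h)) (miss h j<k)
      where
      wrapped : iterate f (suc k) x ≡ iterate f (suc j) x
      wrapped = begin
        iterate f (suc k) x                      ≡⟨ cong (λ t → iterate f t x) k≡p+j ⟩
        iterate f (suc p + suc j) x              ≡⟨ iterate-+ f (suc p) (suc j) x ⟩
        iterate f (suc j) (iterate f (suc p) x)  ≡⟨ cong (iterate f (suc j)) returns ⟩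
        iterate f (suc j) x                      ∎
        where open ≡-Reasoning

    search-firstHit : (P? : Decidable P) → ∀ {x k} → FirstHit f P x k →
                      search f P? n x ≡ iterate f (suc k) x
    search-firstHit P? h = search-reaches P? h (firstHit-< h)

    firstHit-exists : Decidable P → ∀ {x} → P x → ∃ λ k → FirstHit f P x k
    firstHit-exists P? {x} px with p , _ , returns ← orbit-returns x =
      firstHit-within P? p (subst P (sym returns) px)

    firstHit-reverse : ∀ {x k} → P x → FirstHit f P x k → FirstHit g P (iterate f (suc k) x) k
    firstHit-reverse {x} {k} px h = record
      { hit  = subst P (sym (iterate-cancel₀ (λ _ → inverseˡ π) (suc k) x)) px
      ; miss = missed }
      where
      missed : ∀ {i} → i < k → ¬ P (iterate g (suc i) (iterate f (suc k) x))
      missed {i} i<k with j , j<k , k≡i+j ← <-split i<k = miss h j<k ∘ subst P (begin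
        iterate g (suc i) (iterate f (suc k) x)          ≡⟨ cong (λ t → iterate g (suc i) (iterate f t x)) k≡i+j ⟩
        iterate g (suc i) (iterate f (suc i + suc j) x)  ≡⟨ iterate-cancel (λ _ → inverseˡ π) (suc i) (suc j) x ⟩
        iterate f (suc j) x                              ∎)
        where open ≡-Reasoning

module _ {n : ℕ} (π : Permutation′ n) {P : Fin n → Set} (P? : Decidable P) where

  search-back : ∀ {x k} → P x → FirstHit (π ⟨$⟩ʳ_) P x k →
                search (π ⟨$⟩ˡ_) P? n (iterate (π ⟨$⟩ʳ_) (suc k) x) ≡ x
  search-back {x} {k} px h =
    trans (search-firstHit (flip π) P? (firstHit-reverse π px h))
          (iterate-cancel₀ (λ _ → inverseˡ π) (suc k) x)

  search-hits : ∀ {x} → P x → P (search (π ⟨$⟩ʳ_) P? n x)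
  search-hits px with k , h ← firstHit-exists π P? px =
    subst P (sym (search-firstHit π P? h)) (hit h)

  search-inverse : ∀ {x} → P x → search (π ⟨$⟩ˡ_) P? n (search (π ⟨$⟩ʳ_) P? n x) ≡ x
  search-inverse px with k , h ← firstHit-exists π P? px =
    trans (cong (search (π ⟨$⟩ˡ_) P? n) (search-firstHit π P? h)) (search-back px h)

module _ {n : ℕ} {p q : Permutation′ n} where

  reach-trans : ∀ {x y z} → Reach p q x y → Reach p q y z → Reach p q x z
  reach-trans here     r = r
  reach-trans (pFwd s) r = pFwd (reach-trans s r)
  reach-trans (pBwd s) r = pBwd (reach-trans s r)
  reach-trans (qFwd s) r = qFwd (reach-trans s r)
  reach-trans (qBwd s) r = qBwd (reach-trans s r)

  reach-≡ : ∀ {x y} → x ≡ y → Reach p q x y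
  reach-≡ refl = here

  reach-sym : ∀ {x y} → Reach p q x y → Reach p q y x
  reach-sym here     = here
  reach-sym (pFwd r) = reach-trans (reach-sym r) (pBwd (reach-≡ (inverseˡ p)))
  reach-sym (pBwd r) = reach-trans (reach-sym r) (pFwd (reach-≡ (inverseʳ p)))
  reach-sym (qFwd r) = reach-trans (reach-sym r) (qBwd (reach-≡ (inverseˡ q)))
  reach-sym (qBwd r) = reach-trans (reach-sym r) (qFwd (reach-≡ (inverseʳ q)))

  reach-iterate : ∀ {f} → (∀ x → Reach p q x (f x)) → ∀ k x → Reach p q x (iterate f k x)
  reach-iterate step zero    x = here
  reach-iterate step (suc k) x = reach-trans (step x) (reach-iterate step k _)

module _ {n : ℕ} {p q p′ q′ : Permutation′ n}
         (p-step : ∀ x → Reach p′ q′ x (p ⟨$⟩ʳ x))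
         (q-step : ∀ x → Reach p′ q′ x (q ⟨$⟩ʳ x)) where

  reach-mono : ∀ {x y} → Reach p q x y → Reach p′ q′ x y
  reach-mono here           = here
  reach-mono (pFwd r)       = reach-trans (p-step _) (reach-mono r)
  reach-mono (pBwd {x} r)   =
    reach-trans (reach-sym (subst (Reach p′ q′ _) (inverseʳ p) (p-step (p ⟨$⟩ˡ x)))) (reach-mono r)
  reach-mono (qFwd r)       = reach-trans (q-step _) (reach-mono r)
  reach-mono (qBwd {x} r)   =
    reach-trans (reach-sym (subst (Reach p′ q′ _) (inverseʳ q) (q-step (q ⟨$⟩ˡ x)))) (reach-mono r)

  transitive-mono : Transitive p q → Transitive p′ q′
  transitive-mono connected x y = reach-mono (connected x y)

data Slope (a b : ℕ) : Set where
  descent : suc b ≡ a → Slope a b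
  flat    : b ≡ a → Slope a b
  ascent  : b ≡ suc a → Slope a b

slope : ∀ a b → ∣ a - b ∣ ≤ 1 → Slope a b
slope zero          zero          _        = flat refl
slope zero          (suc zero)    _        = ascent refl
slope zero          (suc (suc b)) (s≤s ())
slope (suc zero)    zero          _        = descent refl
slope (suc (suc a)) zero          (s≤s ())
slope (suc a)       (suc b)       a≈b with slope a b a≈b
... | descent e = descent (cong suc e)
... | flat e    = flat (cong suc e)
... | ascent e  = ascent (cong suc e)

slope-< : ∀ {a b} → Slope a b → b < a → suc b ≡ a
slope-< (descent e) _   = e
slope-< (flat e)    b<a = contradiction e (<⇒≢ b<a)
slope-< (ascent e)  b<a = contradiction (subst (_< _) e b<a) (<-asym (n<1+n _))

descent-ascent-exclusive : ∀ {a b} → suc b ≡ a → b ≡ suc a → ⊥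
descent-ascent-exclusive {b = b} refl e = <-irrefl e (m<n⇒m<1+n (n<1+n b))

maxLevel : ∀ {n} → (Fin n → ℕ) → ℕ
maxLevel {n} L = max 0 (map L (allFin n))

level≤maxLevel : ∀ {n} (L : Fin n → ℕ) x → L x ≤ maxLevel L
level≤maxLevel {n} L x = All.lookup (xs≤max 0 (map L (allFin n))) (∈-map⁺ L (∈-allFin x))

⟨$⟩ʳ-injective : ∀ {n} (π : Permutation′ n) {x y} → π ⟨$⟩ʳ x ≡ π ⟨$⟩ʳ y → x ≡ y
⟨$⟩ʳ-injective π {x} {y} e = trans (sym (inverseˡ π)) (trans (cong (π ⟨$⟩ˡ_) e) (inverseˡ π))

-- (ρ, α, L) is a labelled map with face permutation θ, and σ acts on its flat and
-- ascending half-edges as the product ∏ π_e does.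
record Compatible {n : ℕ} (θ σ ρ α : Permutation′ n) (L : Fin n → ℕ) : Set where
  field
    α-involutive : ∀ x → α ⟨$⟩ʳ (α ⟨$⟩ʳ x) ≡ x
    face         : ∀ x → ρ ⟨$⟩ˡ (α ⟨$⟩ʳ x) ≡ θ ⟨$⟩ʳ x
    level-ρ      : ∀ x → L (ρ ⟨$⟩ʳ x) ≡ L x
    adjacent     : ∀ x → ∣ L x - L (α ⟨$⟩ʳ x) ∣ ≤ 1
    σ-flat       : ∀ x → L (α ⟨$⟩ʳ x) ≡ L x → σ ⟨$⟩ʳ x ≡ α ⟨$⟩ʳ x
    σ-ascent     : ∀ x → L (α ⟨$⟩ʳ x) ≡ suc (L x) → σ ⟨$⟩ʳ x ≡ x

module CompatibleProperties {n : ℕ} {θ σ ρ α : Permutation′ n} {L : Fin n → ℕ}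
                            (compatible : Compatible θ σ ρ α L) where

  open Compatible compatible

  τ : Fin n → Fin n
  τ x = θ ⟨$⟩ʳ (σ ⟨$⟩ʳ x)

  ρ⁻¹≡θα : ∀ x → ρ ⟨$⟩ˡ x ≡ θ ⟨$⟩ʳ (α ⟨$⟩ʳ x)
  ρ⁻¹≡θα x = trans (cong (ρ ⟨$⟩ˡ_) (sym (α-involutive x))) (face (α ⟨$⟩ʳ x))

  ρ≡αθ⁻¹ : ∀ x → ρ ⟨$⟩ʳ x ≡ α ⟨$⟩ʳ (θ ⟨$⟩ˡ x)
  ρ≡αθ⁻¹ x = begin
    ρ ⟨$⟩ʳ x                                          ≡⟨ cong (ρ ⟨$⟩ʳ_) (inverseʳ θ) ⟨
    ρ ⟨$⟩ʳ (θ ⟨$⟩ʳ (θ ⟨$⟩ˡ x))                         ≡⟨ cong (ρ ⟨$⟩ʳ_) (face (θ ⟨$⟩ˡ x)) ⟨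
    ρ ⟨$⟩ʳ (ρ ⟨$⟩ˡ (α ⟨$⟩ʳ (θ ⟨$⟩ˡ x)))                ≡⟨ inverseʳ ρ ⟩
    α ⟨$⟩ʳ (θ ⟨$⟩ˡ x)                                 ∎
    where open ≡-Reasoning

  level-ρ⁻¹ : ∀ x → L (ρ ⟨$⟩ˡ x) ≡ L x
  level-ρ⁻¹ x = trans (sym (level-ρ (ρ ⟨$⟩ˡ x))) (cong L (inverseʳ ρ))

  level-θ : ∀ x → L (θ ⟨$⟩ʳ x) ≡ L (α ⟨$⟩ʳ x)
  level-θ x = trans (cong L (sym (face x))) (level-ρ⁻¹ (α ⟨$⟩ʳ x))

  level-α² : ∀ x → L (α ⟨$⟩ʳ (α ⟨$⟩ʳ x)) ≡ L x
  level-α² x = cong L (α-involutive x)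

  slope-α : ∀ x → Slope (L x) (L (α ⟨$⟩ʳ x))
  slope-α x = slope (L x) (L (α ⟨$⟩ʳ x)) (adjacent x)

  Descends : Fin n → Set
  Descends x = L (α ⟨$⟩ʳ x) < L x

  descends? : Decidable Descends
  descends? x = L (α ⟨$⟩ʳ x) <? L x

  descends-slope : ∀ {x} → Descends x → suc (L (α ⟨$⟩ʳ x)) ≡ L x
  descends-slope {x} = slope-< (slope-α x)

  RotatesDescents : Set
  RotatesDescents = ∀ x → Descends x → σ ⟨$⟩ʳ x ≡ search (ρ ⟨$⟩ʳ_) descends? n x

  Excursion : Fin n → Set
  Excursion x = FirstReturn τ L x (θ ⟨$⟩ʳ (α ⟨$⟩ʳ x))

  ExcursionsAt : ℕ → Set
  ExcursionsAt h = ∀ x → L x ≡ h → L (α ⟨$⟩ʳ x) ≡ suc (L x) → Excursion x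

  Excursions : Set
  Excursions = ∀ x → L (α ⟨$⟩ʳ x) ≡ suc (L x) → Excursion x

  record PathAbove (h : ℕ) (x y : Fin n) : Set where
    field
      steps   : ℕ
      arrives : iterate τ steps x ≡ y
      above   : ∀ {s} → s < steps → h < L (iterate τ (suc s) x)

  open PathAbove

  pathAbove-step : ∀ {h x} → h < L (τ x) → PathAbove h x (τ x)
  pathAbove-step h<τx = record { steps = 1 ; arrives = refl ; above = λ { (s≤s z≤n) → h<τx } }

  pathAbove-++ : ∀ {h x y z} → PathAbove h x y → PathAbove h y z → PathAbove h x z
  pathAbove-++ {h} {x} {y} p q = record
    { steps   = steps p + steps q
    ; arrives = trans (iterate-+ τ (steps p) (steps q) x)
                      (trans (cong (iterate τ (steps q)) (arrives p)) (arrives q))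
    ; above   = above′ }
    where
    above′ : ∀ {s} → s < steps p + steps q → h < L (iterate τ (suc s) x)
    above′ {s} s<t with s <? steps p
    ... | yes s<p = above p s<p
    ... | no s≮p with s′ , p+s′≡s ← m≤n⇒∃[o]m+o≡n (≮⇒≥ s≮p) =
      subst (λ z → h < L z) (sym shift) (above q (+-cancelˡ-< (steps p) _ _ s′<))
      where
      s′< : steps p + s′ < steps p + steps q
      s′< = subst (_< _) (sym p+s′≡s) s<t
      shift : iterate τ (suc s) x ≡ iterate τ (suc s′) y
      shift = begin
        iterate τ (suc s) x                          ≡⟨ cong (λ t → iterate τ (suc t) x) p+s′≡s ⟨
        iterate τ (suc (steps p + s′)) x             ≡⟨ cong (λ t → iterate τ t x) (+-suc (steps p) s′) ⟨
        iterate τ (steps p + suc s′) x               ≡⟨ iterate-+ τ (steps p) (suc s′) x ⟩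
        iterate τ (suc s′) (iterate τ (steps p) x)   ≡⟨ cong (iterate τ (suc s′)) (arrives p) ⟩
        iterate τ (suc s′) y                         ∎
        where open ≡-Reasoning

  pathAbove-return : ∀ {x y} → PathAbove (L x) x y → L (τ y) ≤ L x → FirstReturn τ L x (τ y)
  pathAbove-return {x} {y} p τy≤x = steps p ,
    record { hit  = subst (λ z → L z ≤ L x) (sym arrival) τy≤x
           ; miss = λ i<t → <⇒≱ (above p i<t) } ,
    arrival
    where
    arrival : iterate τ (suc (steps p)) x ≡ τ y
    arrival = trans (iterate-suc τ (steps p) x) (cong τ (arrives p))

  record PreviousDescent (h : ℕ) (d : Fin n) : Set where
    field
      previous   : Fin n
      descends   : Descends previous
      level      : L previous ≡ suc h
      path       : PathAbove h (α ⟨$⟩ʳ d) previous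
      next-is-d  : search (ρ ⟨$⟩ʳ_) descends? n previous ≡ d

  module _ {h : ℕ} (excursions : ExcursionsAt (suc h)) where

    corner-path : ∀ x → L x ≡ suc h → ¬ Descends x → PathAbove h x (ρ ⟨$⟩ˡ x)
    corner-path x Lx≡1+h ¬x↓ with slope-α x
    ... | descent e = contradiction (≤-reflexive e) ¬x↓
    ... | flat e    = subst (PathAbove h x) τx≡ρ⁻¹x (pathAbove-step (≤-reflexive (sym level)))
      where
      τx≡ρ⁻¹x : τ x ≡ ρ ⟨$⟩ˡ x
      τx≡ρ⁻¹x = trans (cong (θ ⟨$⟩ʳ_) (σ-flat x e)) (sym (ρ⁻¹≡θα x))
      level : L (τ x) ≡ suc h
      level = trans (cong L τx≡ρ⁻¹x) (trans (level-ρ⁻¹ x) Lx≡1+h)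
    ... | ascent e with k , fh , arrival ← excursions x Lx≡1+h e = record
      { steps   = suc k
      ; arrives = trans arrival (sym (ρ⁻¹≡θα x))
      ; above   = above′ }
      where
      above′ : ∀ {s} → s < suc k → h < L (iterate τ (suc s) x)
      above′ s<1+k with m<1+n⇒m<n∨m≡n s<1+k
      ... | inj₁ s<k  = <-trans (subst (h <_) (sym Lx≡1+h) (n<1+n h)) (≰⇒> (miss fh s<k))
      ... | inj₂ refl = ≤-reflexive (sym (begin
        L (iterate τ (suc k) x)        ≡⟨ cong L arrival ⟩
        L (θ ⟨$⟩ʳ (α ⟨$⟩ʳ x))           ≡⟨ level-θ (α ⟨$⟩ʳ x) ⟩
        L (α ⟨$⟩ʳ (α ⟨$⟩ʳ x))           ≡⟨ level-α² x ⟩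
        L x                            ≡⟨ Lx≡1+h ⟩
        suc h                          ∎))
        where open ≡-Reasoning

    -- Each corner met is flat (one τ-step) or ascending (an excursion above h + 1).
    around-vertex : ∀ d → L d ≡ suc h → Descends d → ∀ k →
                    (∀ {i} → i < k → ¬ Descends (iterate (ρ ⟨$⟩ˡ_) (suc i) d)) →
                    PathAbove h (α ⟨$⟩ʳ d) (iterate (ρ ⟨$⟩ˡ_) (suc k) d)
    around-vertex d Ld≡1+h d↓ zero _ =
      subst (PathAbove h (α ⟨$⟩ʳ d)) ταd≡ρ⁻¹d (pathAbove-step (≤-reflexive (sym level)))
      where
      αd-ascends : L (α ⟨$⟩ʳ (α ⟨$⟩ʳ d)) ≡ suc (L (α ⟨$⟩ʳ d))
      αd-ascends = trans (level-α² d) (sym (descends-slope d↓))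
      ταd≡ρ⁻¹d : τ (α ⟨$⟩ʳ d) ≡ ρ ⟨$⟩ˡ d
      ταd≡ρ⁻¹d = trans (cong (θ ⟨$⟩ʳ_) (σ-ascent (α ⟨$⟩ʳ d) αd-ascends)) (sym (ρ⁻¹≡θα d))
      level : L (τ (α ⟨$⟩ʳ d)) ≡ suc h
      level = trans (cong L ταd≡ρ⁻¹d) (trans (level-ρ⁻¹ d) Ld≡1+h)
    around-vertex d Ld≡1+h d↓ (suc k) no-descent =
      subst (PathAbove h (α ⟨$⟩ʳ d)) (sym (iterate-suc (ρ ⟨$⟩ˡ_) (suc k) d))
        (pathAbove-++ (around-vertex d Ld≡1+h d↓ k (no-descent ∘ m<n⇒m<1+n))
                      (corner-path corner level (no-descent (n<1+n k))))
      where
      corner = iterate (ρ ⟨$⟩ˡ_) (suc k) d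
      level : L corner ≡ suc h
      level = trans (iterate-invariant L level-ρ⁻¹ (suc k) d) Ld≡1+h

    previous-descent : ∀ d → L d ≡ suc h → Descends d → PreviousDescent h d
    previous-descent d Ld≡1+h d↓ with k , fh ← firstHit-exists (flip ρ) descends? d↓ = record
      { previous  = iterate (ρ ⟨$⟩ˡ_) (suc k) d
      ; descends  = hit fh
      ; level     = trans (iterate-invariant L level-ρ⁻¹ (suc k) d) Ld≡1+h
      ; path      = around-vertex d Ld≡1+h d↓ k (miss fh)
      ; next-is-d = search-back (flip ρ) descends? d↓ fh }

  excursions-from-rotation : RotatesDescents → Excursions
  excursions-from-rotation rotates x = below (maxLevel L) x (m≤n+m (maxLevel L) (L x))
    where
    -- downward induction on L x, through the excursions at level L x + 1
    below : ∀ k x → maxLevel L ≤ L x + k → L (α ⟨$⟩ʳ x) ≡ suc (L x) → Excursion x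
    below zero x max≤x αx-ascends = contradiction (level≤maxLevel L (α ⟨$⟩ʳ x)) (<⇒≱ max<αx)
      where
      max<αx : maxLevel L < L (α ⟨$⟩ʳ x)
      max<αx = subst (maxLevel L <_) (sym αx-ascends)
                     (s≤s (subst (maxLevel L ≤_) (+-identityʳ (L x)) max≤x))
    below (suc k) x max≤x αx-ascends =
      subst (FirstReturn τ L x) τprevious≡θαx
        (pathAbove-return (subst (λ z → PathAbove (L x) z previous) (α-involutive x) path)
                          (≤-reflexive (trans (cong L τprevious≡θαx) (trans (level-θ (α ⟨$⟩ʳ x)) (level-α² x)))))
      where
      αx↓ : Descends (α ⟨$⟩ʳ x)
      αx↓ = subst (_< L (α ⟨$⟩ʳ x)) (sym (level-α² x)) (≤-reflexive (sym αx-ascends))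
      higher : ExcursionsAt (suc (L x))
      higher x′ Lx′≡1+x = below k x′ (subst (λ l → maxLevel L ≤ l + k) (sym Lx′≡1+x)
                                            (subst (maxLevel L ≤_) (+-suc (L x) k) max≤x))
      open PreviousDescent (previous-descent higher (α ⟨$⟩ʳ x) αx-ascends αx↓)
      τprevious≡θαx : τ previous ≡ θ ⟨$⟩ʳ (α ⟨$⟩ʳ x)
      τprevious≡θαx = cong (θ ⟨$⟩ʳ_) (trans (rotates previous descends) next-is-d)

  rotation-from-excursions : Excursions → (∀ x → L (σ ⟨$⟩ʳ x) ≡ L x) →
                             (∀ x → Descends x → Descends (σ ⟨$⟩ʳ x)) → RotatesDescents
  rotation-from-excursions excursions σ-level σ-descends d d↓ = begin
    σ ⟨$⟩ʳ d                               ≡⟨ next-is-d ⟨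
    search (ρ ⟨$⟩ʳ_) descends? n previous  ≡⟨ cong (search (ρ ⟨$⟩ʳ_) descends? n) previous≡d ⟩
    search (ρ ⟨$⟩ʳ_) descends? n d         ∎
    where
    open ≡-Reasoning
    d′ = σ ⟨$⟩ʳ d
    d′↓ = σ-descends d d↓
    open PreviousDescent (previous-descent (λ x _ → excursions x) d′ (sym (descends-slope d′↓)) d′↓)
    level-τ : L (τ previous) ≡ L (α ⟨$⟩ʳ d′)
    level-τ = suc-injective (begin
      suc (L (τ previous))                         ≡⟨ cong suc (level-θ (σ ⟨$⟩ʳ previous)) ⟩
      suc (L (α ⟨$⟩ʳ (σ ⟨$⟩ʳ previous)))           ≡⟨ descends-slope (σ-descends previous descends) ⟩
      L (σ ⟨$⟩ʳ previous)                          ≡⟨ σ-level previous ⟩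
      L previous                                   ≡⟨ level ⟩
      suc (L (α ⟨$⟩ʳ d′))                          ∎)
    returns-to-τ : FirstReturn τ L (α ⟨$⟩ʳ d′) (τ previous)
    returns-to-τ = pathAbove-return path (≤-reflexive level-τ)
    returns-to-θ : Excursion (α ⟨$⟩ʳ d′)
    returns-to-θ = excursions (α ⟨$⟩ʳ d′) (trans (level-α² d′) (sym (descends-slope d′↓)))
    previous≡d : previous ≡ d
    previous≡d = ⟨$⟩ʳ-injective σ (⟨$⟩ʳ-injective θ
      (trans (firstReturn-unique returns-to-τ returns-to-θ) (cong (θ ⟨$⟩ʳ_) (α-involutive d′))))

  module _ (excursions : Excursions) where

    reach-α-ascent : ∀ x → L (α ⟨$⟩ʳ x) ≡ suc (L x) → Reach θ σ x (α ⟨$⟩ʳ x)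
    reach-α-ascent x up with k , _ , arrival ← excursions x up =
      reach-trans (subst (Reach θ σ x) arrival (reach-iterate (λ _ → qFwd (pFwd here)) (suc k) x))
                  (pBwd (reach-≡ (inverseˡ θ)))

    reach-α : ∀ x → Reach θ σ x (α ⟨$⟩ʳ x)
    reach-α x with slope-α x
    ... | descent e = reach-sym (subst (Reach θ σ _) (α-involutive x)
                                       (reach-α-ascent (α ⟨$⟩ʳ x) (trans (level-α² x) (sym e))))
    ... | flat e    = qFwd (reach-≡ (σ-flat x e))
    ... | ascent e  = reach-α-ascent x e

    reach-ρ : ∀ x → Reach θ σ x (ρ ⟨$⟩ʳ x)
    reach-ρ x = pBwd (subst (Reach θ σ _) (sym (ρ≡αθ⁻¹ x)) (reach-α (θ ⟨$⟩ˡ x)))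

    transitive-θσ : Transitive ρ α → Transitive θ σ
    transitive-θσ = transitive-mono reach-ρ reach-α

  reach-σ : RotatesDescents → ∀ x → Reach ρ α x (σ ⟨$⟩ʳ x)
  reach-σ rotates x with slope-α x
  ... | descent e with k , fh ← firstHit-exists ρ descends? (≤-reflexive e) =
    subst (Reach ρ α x) (sym (trans (rotates x (≤-reflexive e)) (search-firstHit ρ descends? fh)))
          (reach-iterate (λ _ → pFwd here) (suc k) x)
  ... | flat e    = qFwd (reach-≡ (sym (σ-flat x e)))
  ... | ascent e  = reach-≡ (sym (σ-ascent x e))

  reach-θ : ∀ x → Reach ρ α x (θ ⟨$⟩ʳ x)
  reach-θ x = qFwd (pBwd (reach-≡ (face x)))

  transitive-ρα : RotatesDescents → Transitive θ σ → Transitive ρ α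
  transitive-ρα rotates = transitive-mono reach-θ (reach-σ rotates)

  module _ (rotates : RotatesDescents) where

    σ-level-of-rotation : ∀ x → L (σ ⟨$⟩ʳ x) ≡ L x
    σ-level-of-rotation x with slope-α x
    ... | descent e = trans (cong L (rotates x (≤-reflexive e)))
                            (search-invariant L level-ρ descends? n x)
    ... | flat e    = trans (cong L (σ-flat x e)) e
    ... | ascent e  = cong L (σ-ascent x e)

    σ-descends-of-rotation : ∀ x → Descends x → Descends (σ ⟨$⟩ʳ x)
    σ-descends-of-rotation x x↓ =
      subst Descends (sym (rotates x x↓)) (search-hits ρ descends? x↓)

  Δ-⇒descends : ∀ {x} → InΔ- θ L x → Descends x
  Δ-⇒descends {x} e = subst (_< L x) (level-θ x) (≤-reflexive e)

  descends⇒Δ- : ∀ {x} → Descends x → InΔ- θ L x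
  descends⇒Δ- {x} x↓ = trans (cong suc (level-θ x)) (descends-slope x↓)

if-cong : ∀ {A : Set} {b b′ : Bool} {x x′ y y′ : A} → b ≡ b′ → x ≡ x′ → y ≡ y′ →
          (if b then x else y) ≡ (if b′ then x′ else y′)
if-cong refl refl refl = refl

module _ {n : ℕ} {θ : Permutation′ n} (m : S θ) where

  open S m

  Down? : Decidable (Down m)
  Down? v = ℓ (α ⟨$⟩ʳ v) <? ℓ v

  -- prodπ m with the rotation ρ replaced by r; for r = ρ⁻¹ it is the inverse of prodπ m
  product : (Fin n → Fin n) → Fin n → Fin n
  product r u = if down? m u then search r Down? n u
                else (if does (ℓ u ≟ ℓ (α ⟨$⟩ʳ u)) then α ⟨$⟩ʳ u else u)

  searchDown≡search : ∀ N u → searchDown m N u ≡ search (ρ ⟨$⟩ʳ_) Down? N u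
  searchDown≡search zero    u = refl
  searchDown≡search (suc N) u =
    cong (if down? m (ρ ⟨$⟩ʳ u) then ρ ⟨$⟩ʳ u else_) (searchDown≡search N (ρ ⟨$⟩ʳ u))

  prodπ≡product : ∀ u → prodπ m u ≡ product (ρ ⟨$⟩ʳ_) u
  prodπ≡product u = cong (λ v → if down? m u then v else _) (searchDown≡search n u)

  module _ (r : Fin n → Fin n) (u : Fin n) where

    product-descends : Down m u → product r u ≡ search r Down? n u
    product-descends u↓ rewrite dec-true (ℓ (α ⟨$⟩ʳ u) <? ℓ u) u↓ = refl

    product-flat : ℓ (α ⟨$⟩ʳ u) ≡ ℓ u → product r u ≡ α ⟨$⟩ʳ u
    product-flat e rewrite dec-false (ℓ (α ⟨$⟩ʳ u) <? ℓ u) (<-irrefl e)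
                         | dec-true (ℓ u ≟ ℓ (α ⟨$⟩ʳ u)) (sym e) = refl

    product-ascent : ℓ (α ⟨$⟩ʳ u) ≡ suc (ℓ u) → product r u ≡ u
    product-ascent e rewrite dec-false (ℓ (α ⟨$⟩ʳ u) <? ℓ u) (<-asym (≤-reflexive (sym e)))
                           | dec-false (ℓ u ≟ ℓ (α ⟨$⟩ʳ u)) (<⇒≢ (≤-reflexive (sym e))) = refl

  product-inverse : (π : Permutation′ n) → ∀ u → product (π ⟨$⟩ˡ_) (product (π ⟨$⟩ʳ_) u) ≡ u
  product-inverse π u with slope (ℓ u) (ℓ (α ⟨$⟩ʳ u)) (ℓ-adj u)
  ... | descent e = begin
    product (π ⟨$⟩ˡ_) (product (π ⟨$⟩ʳ_) u)              ≡⟨ cong (product (π ⟨$⟩ˡ_)) (product-descends _ u u↓) ⟩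
    product (π ⟨$⟩ˡ_) (search (π ⟨$⟩ʳ_) Down? n u)        ≡⟨ product-descends _ _ (search-hits π Down? u↓) ⟩
    search (π ⟨$⟩ˡ_) Down? n (search (π ⟨$⟩ʳ_) Down? n u) ≡⟨ search-inverse π Down? u↓ ⟩
    u                                                    ∎
    where
    open ≡-Reasoning
    u↓ : Down m u
    u↓ = ≤-reflexive e
  ... | flat e = trans (cong (product (π ⟨$⟩ˡ_)) (product-flat _ u e))
                       (trans (product-flat _ (α ⟨$⟩ʳ u) (trans (cong ℓ (α-invol u)) (sym e))) (α-invol u))
  ... | ascent e = trans (cong (product (π ⟨$⟩ˡ_)) (product-ascent _ u e)) (product-ascent _ u e)

prodπ-cong : ∀ {n} {θ : Permutation′ n} (m m′ : S θ) → m ≈S m′ → ∀ u → prodπ m u ≡ prodπ m′ u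
prodπ-cong {n} m m′ (ρ≗ , α≗ , ℓ≗) u = begin
  prodπ m u                  ≡⟨ prodπ≡product m u ⟩
  product m (ρ ⟨$⟩ʳ_) u       ≡⟨ if-cong (down≗ u) (search-cong _ _ ρ≗ down≗ n u)
                                        (if-cong (cong₂ (λ a b → does (a ≟ b)) (ℓ≗ u) (αℓ≗ u)) (α≗ u) refl) ⟩
  product m′ (ρ′ ⟨$⟩ʳ_) u     ≡⟨ prodπ≡product m′ u ⟨
  prodπ m′ u                 ∎
  where
  open ≡-Reasoning
  open S m
  open S m′ using () renaming (ρ to ρ′; α to α′; ℓ to ℓ′)
  αℓ≗ : ∀ v → ℓ (α ⟨$⟩ʳ v) ≡ ℓ′ (α′ ⟨$⟩ʳ v)
  αℓ≗ v = trans (cong ℓ (α≗ v)) (ℓ≗ _)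
  down≗ : ∀ v → does (ℓ (α ⟨$⟩ʳ v) <? ℓ v) ≡ does (ℓ′ (α′ ⟨$⟩ʳ v) <? ℓ′ v)
  down≗ v = cong₂ (λ a b → does (a <? b)) (αℓ≗ v) (ℓ≗ v)

module ToMap {n : ℕ} {θ : Permutation′ n} (c : C θ) where

  open C c renaming (trans to connected)

  τ : Permutation′ n
  τ = σ ∘ₚ θ

  σ-level : ∀ x → γ (σ ⟨$⟩ʳ x) ≡ γ x
  σ-level = proj₁ inSγ

  σ-descent : ∀ x → InΔ- θ γ x → InΔ- θ γ (σ ⟨$⟩ʳ x)
  σ-descent = proj₁ (proj₂ inSγ)

  σ-ascent : ∀ x → InΔ+ θ γ x → σ ⟨$⟩ʳ x ≡ x
  σ-ascent = proj₁ (proj₂ (proj₂ inSγ))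

  σ-flat : ∀ x → InΔ0 θ γ x → InΔ0 θ γ (σ ⟨$⟩ʳ x) × σ ⟨$⟩ʳ (σ ⟨$⟩ʳ x) ≡ x × σ ⟨$⟩ʳ x ≢ x
  σ-flat = proj₂ (proj₂ (proj₂ inSγ))

  slope-θ : ∀ x → Slope (γ x) (γ (θ ⟨$⟩ʳ x))
  slope-θ x = slope (γ x) (γ (θ ⟨$⟩ʳ x)) (proj₂ motz x)

  τ-descent : ∀ x → InΔ- θ γ x → suc (γ (τ ⟨$⟩ʳ x)) ≡ γ x
  τ-descent x e = trans (σ-descent x e) (σ-level x)

  τ-flat : ∀ x → InΔ0 θ γ x → γ (τ ⟨$⟩ʳ x) ≡ γ x
  τ-flat x e = trans (proj₁ (σ-flat x e)) (σ-level x)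

  τ-ascent : ∀ x → InΔ+ θ γ x → γ (τ ⟨$⟩ʳ x) ≡ suc (γ x)
  τ-ascent x e = trans (cong (λ y → γ (θ ⟨$⟩ʳ y)) (σ-ascent x e)) e

  drops-only-at-descent : ∀ x → γ (τ ⟨$⟩ʳ x) < γ x → InΔ- θ γ x
  drops-only-at-descent x τx<x with slope-θ x
  ... | descent e = e
  ... | flat e    = contradiction (τ-flat x e) (<⇒≢ τx<x)
  ... | ascent e  = contradiction (subst (_< γ x) (τ-ascent x e) τx<x) (<-asym (n<1+n (γ x)))

  rises-only-at-ascent : ∀ x → γ x < γ (τ ⟨$⟩ʳ x) → InΔ+ θ γ x
  rises-only-at-ascent x x<τx with slope-θ x
  ... | descent e = contradiction (subst (_< γ (τ ⟨$⟩ʳ x)) (sym (τ-descent x e)) x<τx) (<-asym (n<1+n _))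
  ... | flat e    = contradiction (sym (τ-flat x e)) (<⇒≢ x<τx)
  ... | ascent e  = e

  below? : ∀ c → Decidable (λ y → γ y ≤ c)
  below? c y = γ y ≤? c

  α : Fin n → Fin n
  α x = if does (γ (θ ⟨$⟩ʳ x) <? γ x)
          then search (τ ⟨$⟩ˡ_) (below? (γ (θ ⟨$⟩ʳ x))) n (θ ⟨$⟩ʳ x)
          else (if does (γ x <? γ (θ ⟨$⟩ʳ x))
                  then θ ⟨$⟩ˡ search (τ ⟨$⟩ʳ_) (below? (γ x)) n x
                  else σ ⟨$⟩ʳ x)

  α-descent : ∀ x → InΔ- θ γ x → α x ≡ search (τ ⟨$⟩ˡ_) (below? (γ (θ ⟨$⟩ʳ x))) n (θ ⟨$⟩ʳ x)
  α-descent x e rewrite dec-true (γ (θ ⟨$⟩ʳ x) <? γ x) (≤-reflexive e) = refl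

  α-ascent : ∀ x → InΔ+ θ γ x → α x ≡ θ ⟨$⟩ˡ search (τ ⟨$⟩ʳ_) (below? (γ x)) n x
  α-ascent x e rewrite dec-false (γ (θ ⟨$⟩ʳ x) <? γ x) (<-asym (≤-reflexive (sym e)))
                     | dec-true (γ x <? γ (θ ⟨$⟩ʳ x)) (≤-reflexive (sym e)) = refl

  α-flat : ∀ x → InΔ0 θ γ x → α x ≡ σ ⟨$⟩ʳ x
  α-flat x e rewrite dec-false (γ (θ ⟨$⟩ʳ x) <? γ x) (<-irrefl e)
                   | dec-false (γ x <? γ (θ ⟨$⟩ʳ x)) (<-irrefl (sym e)) = refl

  ascent-returns : ∀ u → InΔ+ θ γ u → FirstReturn (τ ⟨$⟩ʳ_) γ u (θ ⟨$⟩ʳ α u)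
  ascent-returns u up with k , fh ← firstHit-exists τ (below? (γ u)) (≤-refl {γ u}) =
    k , fh , (begin
      iterate (τ ⟨$⟩ʳ_) (suc k) u                               ≡⟨ search-firstHit τ _ fh ⟨
      search (τ ⟨$⟩ʳ_) _ n u                                    ≡⟨ inverseʳ θ ⟨
      θ ⟨$⟩ʳ (θ ⟨$⟩ˡ search (τ ⟨$⟩ʳ_) (below? (γ u)) n u)    ≡⟨ cong (θ ⟨$⟩ʳ_) (α-ascent u up) ⟨
      θ ⟨$⟩ʳ α u                                                ∎)
    where open ≡-Reasoning

  return-descends : ∀ u d → InΔ+ θ γ u → FirstReturn (τ ⟨$⟩ʳ_) γ u (θ ⟨$⟩ʳ d) →
                    InΔ- θ γ d × γ d ≡ suc (γ u)
  return-descends u d up (zero , fh , _) =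
    contradiction (hit fh) (<⇒≱ (≤-reflexive (sym (τ-ascent u up))))
  return-descends u d up (suc k , fh , arrival) =
    subst (InΔ- θ γ) σw≡d (σ-descent w w↓) ,
    trans (cong γ (sym σw≡d)) (trans (σ-level w) (trans (sym (τ-descent w w↓)) (cong suc τw≡u)))
    where
    w = iterate (τ ⟨$⟩ʳ_) (suc k) u
    u<w : γ u < γ w
    u<w = ≰⇒> (miss fh (n<1+n k))
    τw≤u : γ (τ ⟨$⟩ʳ w) ≤ γ u
    τw≤u = subst (λ z → γ z ≤ γ u) (iterate-suc (τ ⟨$⟩ʳ_) (suc k) u) (hit fh)
    w↓ : InΔ- θ γ w
    w↓ = drops-only-at-descent w (≤-<-trans τw≤u u<w)
    τw≡u : γ (τ ⟨$⟩ʳ w) ≡ γ u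
    τw≡u = ≤-antisym τw≤u (≤-pred (subst (γ u <_) (sym (τ-descent w w↓)) u<w))
    σw≡d : σ ⟨$⟩ʳ w ≡ d
    σw≡d = ⟨$⟩ʳ-injective θ (trans (sym (iterate-suc (τ ⟨$⟩ʳ_) (suc k) u)) arrival)

  ascent-partner : ∀ u → InΔ+ θ γ u → InΔ- θ γ (α u) × γ (α u) ≡ suc (γ u)
  ascent-partner u up = return-descends u (α u) up (ascent-returns u up)

  α-of-return : ∀ u d → InΔ+ θ γ u → FirstReturn (τ ⟨$⟩ʳ_) γ u (θ ⟨$⟩ʳ d) → α u ≡ d
  α-of-return u d up returns = ⟨$⟩ʳ-injective θ (firstReturn-unique (ascent-returns u up) returns)

  α-back-of-return : ∀ u d → InΔ+ θ γ u → FirstReturn (τ ⟨$⟩ʳ_) γ u (θ ⟨$⟩ʳ d) → α d ≡ u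
  α-back-of-return u d up returns@(k , fh , arrival) = begin
    α d                                                           ≡⟨ α-descent d d↓ ⟩
    search (τ ⟨$⟩ˡ_) (below? (γ (θ ⟨$⟩ʳ d))) n (θ ⟨$⟩ʳ d)          ≡⟨ cong (λ l → search _ (below? l) n _) θd≡u ⟩
    search (τ ⟨$⟩ˡ_) (below? (γ u)) n (θ ⟨$⟩ʳ d)                   ≡⟨ cong (search _ _ n) arrival ⟨
    search (τ ⟨$⟩ˡ_) (below? (γ u)) n (iterate (τ ⟨$⟩ʳ_) (suc k) u) ≡⟨ search-back τ _ ≤-refl fh ⟩
    u                                                             ∎
    where
    open ≡-Reasoning
    d↓ : InΔ- θ γ d
    d↓ = proj₁ (return-descends u d up returns)
    θd≡u : γ (θ ⟨$⟩ʳ d) ≡ γ u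
    θd≡u = suc-injective (trans d↓ (proj₂ (return-descends u d up returns)))

  descent-returns : ∀ d → InΔ- θ γ d →
                    InΔ+ θ γ (α d) × γ (α d) ≡ γ (θ ⟨$⟩ʳ d) × FirstReturn (τ ⟨$⟩ʳ_) γ (α d) (θ ⟨$⟩ʳ d)
  descent-returns d d↓ with firstHit-exists (flip τ) (below? (γ (θ ⟨$⟩ʳ d))) (≤-refl {γ (θ ⟨$⟩ʳ d)})
  ... | zero , fh = contradiction (hit fh) (<⇒≱ (≤-reflexive (trans d↓ (sym level))))
    where
    level : γ (τ ⟨$⟩ˡ (θ ⟨$⟩ʳ d)) ≡ γ d
    level = trans (cong (λ z → γ (σ ⟨$⟩ˡ z)) (inverseˡ θ))
                  (trans (sym (σ-level (σ ⟨$⟩ˡ d))) (cong γ (inverseʳ σ)))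
  ... | suc k , fh = subst (InΔ+ θ γ) X≡αd X↑ , trans (cong γ (sym X≡αd)) γX≡γt ,
                     subst (λ z → FirstReturn (τ ⟨$⟩ʳ_) γ z (θ ⟨$⟩ʳ d)) X≡αd returns
    where
    t = θ ⟨$⟩ʳ d
    V = iterate (τ ⟨$⟩ˡ_) (suc k) t
    X = iterate (τ ⟨$⟩ˡ_) (suc (suc k)) t
    X≡αd : X ≡ α d
    X≡αd = sym (trans (α-descent d d↓) (search-firstHit (flip τ) _ fh))
    τX≡V : τ ⟨$⟩ʳ X ≡ V
    τX≡V = trans (cong (τ ⟨$⟩ʳ_) (iterate-suc (τ ⟨$⟩ˡ_) (suc k) t)) (inverseʳ τ)
    X≤t : γ X ≤ γ t
    X≤t = hit fh
    t<τX : γ t < γ (τ ⟨$⟩ʳ X)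
    t<τX = subst (λ z → γ t < γ z) (sym τX≡V) (≰⇒> (miss fh (n<1+n k)))
    X↑ : InΔ+ θ γ X
    X↑ = rises-only-at-ascent X (≤-<-trans X≤t t<τX)
    γX≡γt : γ X ≡ γ t
    γX≡γt = ≤-antisym X≤t (≤-pred (subst (γ t <_) (τ-ascent X X↑) t<τX))
    reversed : FirstHit (τ ⟨$⟩ʳ_) (λ z → γ z ≤ γ t) X (suc k)
    reversed = firstHit-reverse (flip τ) (≤-refl {γ t}) fh
    returns : FirstReturn (τ ⟨$⟩ʳ_) γ X t
    returns = suc k , subst (λ l → FirstHit (τ ⟨$⟩ʳ_) (λ z → γ z ≤ l) X (suc k)) (sym γX≡γt) reversed ,
              iterate-cancel₀ (λ _ → inverseʳ τ) (suc (suc k)) t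

  α-involutive : ∀ x → α (α x) ≡ x
  α-involutive x with slope-θ x
  ... | descent e with αx↑ , _ , returns ← descent-returns x e = α-of-return (α x) x αx↑ returns
  ... | flat e    = begin
    α (α x)                  ≡⟨ cong α (α-flat x e) ⟩
    α (σ ⟨$⟩ʳ x)              ≡⟨ α-flat (σ ⟨$⟩ʳ x) (proj₁ (σ-flat x e)) ⟩
    σ ⟨$⟩ʳ (σ ⟨$⟩ʳ x)         ≡⟨ proj₁ (proj₂ (σ-flat x e)) ⟩
    x                        ∎
    where open ≡-Reasoning
  ... | ascent e  = α-back-of-return x (α x) e (ascent-returns x e)

  level-θ≡level-α : ∀ x → γ (θ ⟨$⟩ʳ x) ≡ γ (α x)
  level-θ≡level-α x with slope-θ x
  ... | descent e = sym (proj₁ (proj₂ (descent-returns x e)))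
  ... | flat e    = trans e (sym (trans (cong γ (α-flat x e)) (σ-level x)))
  ... | ascent e  = trans e (sym (proj₂ (ascent-partner x e)))

  α-fixed-point-free : ∀ x → α x ≢ x
  α-fixed-point-free x αx≡x with slope-θ x
  ... | descent e = descent-ascent-exclusive e (subst (InΔ+ θ γ) αx≡x (proj₁ (descent-returns x e)))
  ... | flat e    = proj₂ (proj₂ (σ-flat x e)) (trans (sym (α-flat x e)) αx≡x)
  ... | ascent e  = descent-ascent-exclusive (subst (InΔ- θ γ) αx≡x (proj₁ (ascent-partner x e))) e

  αₚ : Permutation′ n
  αₚ = permutation α α α-involutive α-involutive

  ρₚ : Permutation′ n
  ρₚ = permutation (λ x → α (θ ⟨$⟩ˡ x)) (λ x → θ ⟨$⟩ʳ α x)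
         (λ x → trans (cong α (inverseˡ θ)) (α-involutive x))
         (λ x → trans (cong (θ ⟨$⟩ʳ_) (α-involutive (θ ⟨$⟩ˡ x))) (inverseʳ θ))

  compatible : Compatible θ σ ρₚ αₚ γ
  compatible = record
    { α-involutive = α-involutive
    ; face         = λ x → cong (θ ⟨$⟩ʳ_) (α-involutive x)
    ; level-ρ      = λ x → trans (sym (level-θ≡level-α (θ ⟨$⟩ˡ x))) (cong γ (inverseʳ θ))
    ; adjacent     = λ x → subst (λ l → ∣ γ x - l ∣ ≤ 1) (level-θ≡level-α x) (proj₂ motz x)
    ; σ-flat       = λ x e → sym (α-flat x (trans (level-θ≡level-α x) e))
    ; σ-ascent     = λ x e → σ-ascent x (trans (level-θ≡level-α x) e) }

  open CompatibleProperties compatible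
    using (slope-α; Descends; RotatesDescents; rotation-from-excursions; transitive-ρα;
           Δ-⇒descends; descends⇒Δ-)

  rotates : RotatesDescents
  rotates = rotation-from-excursions
    (λ x up → ascent-returns x (trans (level-θ≡level-α x) up))
    σ-level
    (λ x x↓ → Δ-⇒descends (σ-descent x (descends⇒Δ- x↓)))

  Ψ : S θ
  Ψ = record
    { ρ       = ρₚ
    ; α       = αₚ
    ; ℓ       = γ
    ; α-invol = α-involutive
    ; α-fpf   = α-fixed-point-free
    ; conn    = transitive-ρα rotates connected
    ; face    = Compatible.face compatible
    ; ℓ-vert  = Compatible.level-ρ compatible
    ; ℓ-min   = proj₁ motz
    ; ℓ-adj   = Compatible.adjacent compatible }

  σ≡πV : ∀ u → Descends u → σ ⟨$⟩ʳ u ≡ πV Ψ u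
  σ≡πV u u↓ = trans (rotates u u↓) (sym (searchDown≡search Ψ n u))

  σ≡product : ∀ u → σ ⟨$⟩ʳ u ≡ product Ψ (ρₚ ⟨$⟩ʳ_) u
  σ≡product u with slope-α u
  ... | descent e = trans (rotates u (≤-reflexive e)) (sym (product-descends Ψ _ u (≤-reflexive e)))
  ... | flat e    = trans (Compatible.σ-flat compatible u e) (sym (product-flat Ψ _ u e))
  ... | ascent e  = trans (Compatible.σ-ascent compatible u e) (sym (product-ascent Ψ _ u e))

  props : Props c Ψ
  props = (λ u u↓ → descends⇒Δ- u↓ , σ≡πV u u↓ , refl) ,
          (λ u frustrated → trans (level-θ≡level-α u) (sym frustrated) ,
                            Compatible.σ-flat compatible u (sym frustrated)) ,
          (λ u → trans (σ≡product u) (sym (prodπ≡product Ψ u)))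

module FromMap {n : ℕ} {θ : Permutation′ n} (m : S θ) where

  open S m

  σₘ : Permutation′ n
  σₘ = permutation (product m (ρ ⟨$⟩ʳ_)) (product m (ρ ⟨$⟩ˡ_))
                   (product-inverse m (flip ρ)) (product-inverse m ρ)

  compatible : Compatible θ σₘ ρ α ℓ
  compatible = record
    { α-involutive = α-invol
    ; face         = face
    ; level-ρ      = ℓ-vert
    ; adjacent     = ℓ-adj
    ; σ-flat       = product-flat m _
    ; σ-ascent     = product-ascent m _ }

  open CompatibleProperties compatible

  rotates : RotatesDescents
  rotates = product-descends m _

  excursions : Excursions
  excursions = excursions-from-rotation rotates

  σ-flat-involution : ∀ x → InΔ0 θ ℓ x →
                      InΔ0 θ ℓ (σₘ ⟨$⟩ʳ x) × σₘ ⟨$⟩ʳ (σₘ ⟨$⟩ʳ x) ≡ x × σₘ ⟨$⟩ʳ x ≢ x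
  σ-flat-involution x e =
    subst (InΔ0 θ ℓ) (sym σx≡αx) (trans (level-θ (α ⟨$⟩ʳ x)) αx-flat) ,
    trans (cong (σₘ ⟨$⟩ʳ_) σx≡αx) (trans (product-flat m _ (α ⟨$⟩ʳ x) αx-flat) (α-invol x)) ,
    α-fpf x ∘ trans (sym σx≡αx)
    where
    x-flat : ℓ (α ⟨$⟩ʳ x) ≡ ℓ x
    x-flat = trans (sym (level-θ x)) e
    αx-flat : ℓ (α ⟨$⟩ʳ (α ⟨$⟩ʳ x)) ≡ ℓ (α ⟨$⟩ʳ x)
    αx-flat = trans (level-α² x) (sym x-flat)
    σx≡αx : σₘ ⟨$⟩ʳ x ≡ α ⟨$⟩ʳ x
    σx≡αx = product-flat m _ x x-flat

  cC : C θ
  cC = record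
    { γ     = ℓ
    ; σ     = σₘ
    ; motz  = ℓ-min , λ i → subst (λ l → ∣ ℓ i - l ∣ ≤ 1) (sym (level-θ i)) (ℓ-adj i)
    ; inSγ  = σ-level-of-rotation rotates ,
              (λ x x↓ → descends⇒Δ- (σ-descends-of-rotation rotates x (Δ-⇒descends x↓))) ,
              (λ x up → product-ascent m _ x (trans (sym (level-θ x)) up)) ,
              σ-flat-involution
    ; trans = transitive-θσ excursions conn }

  private module Ψ-of-cC = ToMap cC

  α-recovered : ∀ x → Ψ-of-cC.α x ≡ α ⟨$⟩ʳ x
  α-recovered x with slope-α x
  ... | descent e = Ψ-of-cC.α-back-of-return (α ⟨$⟩ʳ x) x (trans (level-θ (α ⟨$⟩ʳ x)) αx-ascends)
                      (subst (λ z → FirstReturn τ ℓ (α ⟨$⟩ʳ x) (θ ⟨$⟩ʳ z)) (α-invol x)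
                             (excursions (α ⟨$⟩ʳ x) αx-ascends))
    where
    αx-ascends : ℓ (α ⟨$⟩ʳ (α ⟨$⟩ʳ x)) ≡ suc (ℓ (α ⟨$⟩ʳ x))
    αx-ascends = trans (level-α² x) (sym e)
  ... | flat e    = trans (Ψ-of-cC.α-flat x (trans (level-θ x) e)) (product-flat m _ x e)
  ... | ascent e  = Ψ-of-cC.α-of-return x (α ⟨$⟩ʳ x) (trans (level-θ x) e) (excursions x e)

  Ψ-cC≈m : ToMap.Ψ cC ≈S m
  Ψ-cC≈m = (λ x → trans (α-recovered (θ ⟨$⟩ˡ x)) (sym (ρ≡αθ⁻¹ x))) , α-recovered , (λ _ → refl)

module _ {n : ℕ} {θ : Permutation′ n} where

  Ψ-cong : (c c′ : C θ) → c ≈C c′ → ToMap.Ψ c ≈S ToMap.Ψ c′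
  Ψ-cong c c′ (γ≗ , σ≗) = (λ x → α≗ (θ ⟨$⟩ˡ x)) , α≗ , γ≗
    where
    open C c using (γ; σ)
    open C c′ using () renaming (γ to γ′; σ to σ′)
    σ⁻¹≗ : ∀ y → σ ⟨$⟩ˡ y ≡ σ′ ⟨$⟩ˡ y
    σ⁻¹≗ y = ⟨$⟩ʳ-injective σ (trans (inverseʳ σ) (sym (trans (σ≗ _) (inverseʳ σ′))))
    does≗ : ∀ {R : ℕ → ℕ → Set} (R? : ∀ a b → Dec (R a b)) y z →
            does (R? (γ y) (γ z)) ≡ does (R? (γ′ y) (γ′ z))
    does≗ R? y z = cong₂ (λ a b → does (R? a b)) (γ≗ y) (γ≗ z)
    α≗ : ∀ x → ToMap.α c x ≡ ToMap.α c′ x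
    α≗ x =
      if-cong (does≗ _<?_ (θ ⟨$⟩ʳ x) x)
        (search-cong _ _ (λ y → σ⁻¹≗ (θ ⟨$⟩ˡ y)) (λ y → does≗ _≤?_ y (θ ⟨$⟩ʳ x)) n (θ ⟨$⟩ʳ x))
        (if-cong (does≗ _<?_ x (θ ⟨$⟩ʳ x))
          (cong (θ ⟨$⟩ˡ_) (search-cong _ _ (λ y → cong (θ ⟨$⟩ʳ_) (σ≗ y)) (λ y → does≗ _≤?_ y x) n x))
          (σ≗ x))

  Ψ-injective : (c c′ : C θ) → ToMap.Ψ c ≈S ToMap.Ψ c′ → c ≈C c′
  Ψ-injective c c′ Ψc≈Ψc′@(_ , _ , γ≗) = γ≗ , λ u → begin
    C.σ c ⟨$⟩ʳ u           ≡⟨ σ≡prodπ c u ⟩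
    prodπ (ToMap.Ψ c) u    ≡⟨ prodπ-cong _ _ Ψc≈Ψc′ u ⟩
    prodπ (ToMap.Ψ c′) u   ≡⟨ σ≡prodπ c′ u ⟨
    C.σ c′ ⟨$⟩ʳ u          ∎
    where
    open ≡-Reasoning
    σ≡prodπ : ∀ c u → C.σ c ⟨$⟩ʳ u ≡ prodπ (ToMap.Ψ c) u
    σ≡prodπ c = proj₂ (proj₂ (ToMap.props c))

theorem3p28 : (n : ℕ) → 1 ≤ n → (θ : Permutation′ n) →
    Σ (C θ → S θ) λ Ψ →
        ((c c' : C θ) → c ≈C c' → Ψ c ≈S Ψ c')
      × ((c c' : C θ) → Ψ c ≈S Ψ c' → c ≈C c')
      × ((s : S θ) → ∃ λ c → Ψ c ≈S s)
      × ((c : C θ) → Props c (Ψ c))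
-- For n = 0 both sets are empty (no label can be 0).
theorem3p28 n _ θ =
  ToMap.Ψ , Ψ-cong , Ψ-injective , (λ m → FromMap.cC m , FromMap.Ψ-cC≈m m) , ToMap.props
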